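{- In the setting described in the context, let $(\ell_1\vee\ell_2\vee\ell_3)$ and $(\ell_1\vee\ell_2\vee\ell_4)$ be two clauses of $\phi_1$ that share the two literals $\ell_1,\ell_2$. Then $\ell_3=\ell_4$.
   Context: Let $G$ be a cocomparability graph with $n$ vertices and $P$ a (strict) partial order whose comparability graph is $\overline{G}$; ground set $U=\{u_1,\dots,u_n\}$, and $V=\{v_1,\dots,v_n\}$ disjoint. Let $\widetilde{E}=\{u_iv_j: u_i<_Pu_j\text{ does not hold}\}$ and let $H$ be the graph on $U\cup V$ with edge set $E_H=\widetilde{E}\cup\{vv':v,v'\in V,v\ne v'\}$. Alternating cycles: in a graph $(W,E)$, vertices $w_1,\dots,w_{2k}$, $k\ge2$ (not necessarily distinct, but $w_i\ne w_{i+1}$, indices mod $2k$) build an $AC_{2k}$ in $F\subseteq E$ if $w_iw_{i+1}\in F$ for even $i$ and $w_iw_{i+1}\notin E$ for odd $i$; its edges are the $w_iw_{i+1}$, $i$ even. Edges $e_1,e_2$ are in conflict if one can write $e_1=ab$, $e_2=cd$ with $a,b,c,d$ distinct and $ad,bc\notin E$. The conflict graph $H^*$ has vertex set $E_H$, two edges adjacent iff in conflict in $H$. Assume $H^*$ is bipartite, fix a proper 2-colouring $\chi_0$ (red/blue) of $H^*$, let $C_1,\dots,C_k$ be its connected components with a boolean variable $x_i$ for $C_i$; for an edge $e$ in $C_i$, $\ell_e=x_i$ if red in $\chi_0$ and $\ell_e=\overline{x_i}$ if blue. $\phi_1$ is the conjunction, over all triples $\{e,e',e''\}$ of edges of $H$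 that are the three edges of some $AC_6$ in $E_H$ and such that no two of $\ell_e,\ell_{e'},\ell_{e''}$ are negations of each other, of the clauses $(\ell_e\vee\ell_{e'}\vee\ell_{e''})$ and $(\overline{\ell_e}\vee\overline{\ell_{e'}}\vee\overline{\ell_{e''}})$. -}

module Defs where

open import Data.Nat using (ℕ)
open import Data.Fin using (Fin; zero; suc; _<_)
open import Data.Sum using (_⊎_; inj₁; inj₂)
open import Data.Product using (_×_; _,_; Σ; ∃; ∃-syntax)
open import Data.Bool using (Bool; true; false; not)
open import Data.Empty using (⊥)
open import Relation.Nullary using (¬_)
open import Relation.Binary.PropositionalEquality using (_≡_; _≢_)
open import Relation.Binary.Construct.Closure.ReflexiveTransitive using (Star)
open import Function.Definitions using (Injective)

-- The graph H built from a strict partial order P on {1..n}.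
-- Vertices:  inj₁ i = u_i ∈ U,   inj₂ j = v_j ∈ V.

module H {n : ℕ} (_<P_ : Fin n → Fin n → Set) where

  W : Set
  W = Fin n ⊎ Fin n

  Adj : W → W → Set
  Adj (inj₁ i) (inj₂ j) = ¬ (i <P j)
  Adj (inj₂ j) (inj₁ i) = ¬ (i <P j)
  Adj (inj₂ j) (inj₂ j') = j ≢ j'
  Adj (inj₁ _) (inj₁ _) = ⊥

  -- edges are handled as ordered pairs of endpoints; (a , b) and (b , a)
  -- denote the same edge ab.
  Pair : Set
  Pair = W × W

  ConflictOrd : W → W → W → W → Set
  ConflictOrd a b c d =
    (a ≢ b) × (a ≢ c) × (a ≢ d) × (b ≢ c) × (b ≢ d) × (c ≢ d) ×
    ¬ Adj a d × ¬ Adj b c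

  Conflict : Pair → Pair → Set
  Conflict (a , b) (c , d) =
    ConflictOrd a b c d ⊎ ConflictOrd b a c d ⊎
    ConflictOrd a b d c ⊎ ConflictOrd b a d c

  -- one step in H*: an edge of the conflict graph, or just re-orienting
  -- the same edge (which is the same vertex of H*)
  Step : Pair → Pair → Set
  Step (a , b) (c , d) =
    Adj a b × Adj c d × (Conflict (a , b) (c , d) ⊎ ((c ≡ b) × (d ≡ a)))

  Connected : Pair → Pair → Set
  Connected = Star Step

  SameEdge : Pair → Pair → Set
  SameEdge (a , b) (c , d) = ((a ≡ c) × (b ≡ d)) ⊎ ((a ≡ d) × (b ≡ c))

  record AC6 (w : Fin 6 → W) : Set where
    field
      d12 : w zero ≢ w (suc zero)
      d23 : w (suc zero) ≢ w (suc (suc zero))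
      d34 : w (suc (suc zero)) ≢ w (suc (suc (suc zero)))
      d45 : w (suc (suc (suc zero))) ≢ w (suc (suc (suc (suc zero))))
      d56 : w (suc (suc (suc (suc zero)))) ≢ w (suc (suc (suc (suc (suc zero)))))
      d61 : w (suc (suc (suc (suc (suc zero))))) ≢ w zero
      n12 : ¬ Adj (w zero) (w (suc zero))
      e23 : Adj (w (suc zero)) (w (suc (suc zero)))
      n34 : ¬ Adj (w (suc (suc zero))) (w (suc (suc (suc zero))))
      e45 : Adj (w (suc (suc (suc zero)))) (w (suc (suc (suc (suc zero)))))
      n56 : ¬ Adj (w (suc (suc (suc (suc zero))))) (w (suc (suc (suc (suc (suc zero))))))
      e61 : Adj (w (suc (suc (suc (suc (suc zero)))))) (w zero)

  ac6Edge : (Fin 6 → W) → Fin 3 → Pair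
  ac6Edge w zero = w (suc zero) , w (suc (suc zero))
  ac6Edge w (suc zero) = w (suc (suc (suc zero))) , w (suc (suc (suc (suc zero))))
  ac6Edge w (suc (suc zero)) = w (suc (suc (suc (suc (suc zero))))) , w zero

  AC6Triple : (Fin 3 → Pair) → Set
  AC6Triple t = ∃[ w ] AC6 w × ∃[ σ ] Injective _≡_ _≡_ σ ×
                  (∀ i → SameEdge (t i) (ac6Edge w (σ i)))

-- Literals.  The components C_1..C_k of H* are labelled by
-- comp : Pair → Fin k  (variable x_i), and χ₀ : Pair → Bool is the fixed
-- proper 2-colouring (true = red, false = blue).

-- a literal over variables x_0..x_{k-1}: (i , true) = x_i, (i , false) = ¬x_i
Lit : ℕ → Set
Lit k = Fin k × Bool

neg : ∀ {k} → Lit k → Lit k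
neg (i , b) = i , not b

pol : ∀ {k} → Bool → Lit k → Lit k
pol true l = l
pol false l = neg l

module Formula {n : ℕ} (_<P_ : Fin n → Fin n → Set) {k : ℕ}
               (comp : H.Pair _<P_ → Fin k) (χ₀ : H.Pair _<P_ → Bool) where
  open H _<P_

  ℓ : Pair → Lit k
  ℓ e = comp e , χ₀ e

  Clauseφ₁ : (Fin 3 → Lit k) → Set
  Clauseφ₁ c = ∃[ t ] AC6Triple t ×
                 (∀ i j → ℓ (t i) ≢ neg (ℓ (t j))) ×
                 ∃[ s ] (∀ i → c i ≡ pol s (ℓ (t i)))

-- An AC₆ of H alternates between U and V, so the three edges of a clause of φ₁ are the edges
-- u_{i+1} v_i of a crown u₀ v₀ u₁ v₁ u₂ v₂ whose pairs u_i v_i are non-edges. When the clause has no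
-- complementary literals, the antipodal pairs u_{i+2} v_i are edges too, each in conflict with a crown
-- edge. Replacing u₀, v₁ by the endpoints of any edge in conflict with the crown edge u₁ v₀ gives a new
-- crown with the same clause (last two literals exchanged, polarity flipped); so a crown can be carried
-- along every path of H* keeping its clause and its pair u₂ v₂. For two clauses sharing ℓ₁ and ℓ₂,
-- carry the second crown onto the edge of ℓ₁ in the first, and then onto the edge of ℓ₂: either a
-- non-edge u_i v_i lands in antipodal position, which is impossible, or an antipodal edge identifies
-- the two third literals.

module Submission where

open import Defs
open import Data.Nat using (ℕ; suc)
open import Data.Nat.Properties using (n<1+n)
open import Data.Fin using (Fin; zero; suc; _<_; _≟_; punchOut; opposite)
open import Data.Fin.Patterns using (0F; 1F; 2F)
open import Data.Fin.Properties using (any?; pigeonhole; punchOut-injective; <⇒≢; opposite-involutive)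
open import Data.Vec.Functional using ([]; _∷_)
open import Data.Bool using (Bool; true; false; not)
open import Data.Bool.Properties using (not-involutive; not-¬; ¬-not)
open import Data.Product using (_×_; _,_; proj₁; proj₂; Σ; ∃; ∃₂)
open import Data.Sum using (inj₁; inj₂)
open import Data.Empty using (⊥-elim)
open import Function using (_∘_)
open import Function.Bundles using (_⇔_; Equivalence)
open import Function.Definitions using (Injective)
open import Function.Consequences.Propositional using (contraInjective)
open import Relation.Nullary using (¬_; yes; no; contradiction)
open import Relation.Binary.PropositionalEquality
  using (_≡_; _≢_; refl; sym; trans; cong; cong₂; subst; subst₂; module ≡-Reasoning)
open import Relation.Binary.Structures using (IsStrictPartialOrder)
open import Relation.Binary.Construct.Closure.ReflexiveTransitive using (ε; _◅_)

next : Fin 3 → Fin 3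
next 0F = 1F
next 1F = 2F
next 2F = 0F

prev : Fin 3 → Fin 3
prev 0F = 2F
prev 1F = 0F
prev 2F = 1F

swap₁₂ : Fin 3 → Fin 3
swap₁₂ 0F = 0F
swap₁₂ 1F = 2F
swap₁₂ 2F = 1F

next∘next≡prev : ∀ i → next (next i) ≡ prev i
next∘next≡prev 0F = refl
next∘next≡prev 1F = refl
next∘next≡prev 2F = refl

next∘prev≡id : ∀ i → next (prev i) ≡ i
next∘prev≡id 0F = refl
next∘prev≡id 1F = refl
next∘prev≡id 2F = refl

swap₁₂-involutive : ∀ i → swap₁₂ (swap₁₂ i) ≡ i
swap₁₂-involutive 0F = refl
swap₁₂-involutive 1F = refl
swap₁₂-involutive 2F = refl

opposite-injective : ∀ {n} → Injective _≡_ _≡_ (opposite {n})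
opposite-injective {x = x} {y} eq =
  trans (sym (opposite-involutive x)) (trans (cong opposite eq) (opposite-involutive y))

injective⇒surjective : ∀ {n} {f : Fin n → Fin n} → Injective _≡_ _≡_ f → ∀ y → ∃ λ x → f x ≡ y
injective⇒surjective {suc n} {f} f-injective y with any? (λ x → f x ≟ y)
... | yes hit = hit
... | no miss = ⊥-elim (no-collision (pigeonhole (n<1+n n) (λ x → punchOut (missed x))))
  where
  missed : ∀ x → y ≢ f x
  missed x y≡fx = miss (x , sym y≡fx)
  no-collision : ¬ ∃₂ λ i j → i < j × punchOut (missed i) ≡ punchOut (missed j)
  no-collision (i , j , i<j , collide) =
    <⇒≢ i<j (f-injective (punchOut-injective (missed i) (missed j) collide))

module _ {k : ℕ} where

  neg-involutive : (l : Lit k) → neg (neg l) ≡ l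
  neg-involutive (i , b) = cong (i ,_) (not-involutive b)

  neg-injective : ∀ {l l′ : Lit k} → neg l ≡ neg l′ → l ≡ l′
  neg-injective {l} {l′} eq =
    trans (sym (neg-involutive l)) (trans (cong neg eq) (neg-involutive l′))

  neg-≢ : (l : Lit k) → l ≢ neg l
  neg-≢ (i , b) eq = not-¬ refl (cong proj₂ eq)

  pol-var : ∀ s (l : Lit k) → proj₁ (pol s l) ≡ proj₁ l
  pol-var true  l       = refl
  pol-var false (i , b) = refl

  pol-injectiveʳ : ∀ s {l l′ : Lit k} → pol s l ≡ pol s l′ → l ≡ l′
  pol-injectiveʳ true  eq = eq
  pol-injectiveʳ false eq = neg-injective eq

  pol-injectiveˡ : ∀ {s s′} (l : Lit k) → pol s l ≡ pol s′ l → s ≡ s′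
  pol-injectiveˡ {true}  {true}  l eq = refl
  pol-injectiveˡ {false} {false} l eq = refl
  pol-injectiveˡ {true}  {false} l eq = ⊥-elim (neg-≢ l eq)
  pol-injectiveˡ {false} {true}  l eq = ⊥-elim (neg-≢ l (sym eq))

  pol-not-neg : ∀ s (l : Lit k) → pol (not s) (neg l) ≡ pol s l
  pol-not-neg true  l = neg-involutive l
  pol-not-neg false l = refl

  same-variable : ∀ {a : Lit k} {s s′ l l′} → a ≡ pol s l → a ≡ pol s′ l′ → proj₁ l ≡ proj₁ l′
  same-variable {s = s} {s′} {l} {l′} a≡l a≡l′ =
    trans (sym (pol-var s l)) (trans (cong proj₁ (trans (sym a≡l) a≡l′)) (pol-var s′ l′))

module Crowns {n : ℕ} (_<P_ : Fin n → Fin n → Set) where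
  open H _<P_

  uv : Fin n → Fin n → Pair
  uv x y = inj₁ x , inj₂ y

  IsEdge : Pair → Set
  IsEdge (a , b) = Adj a b

  Adj-sym : ∀ {a b} → Adj a b → Adj b a
  Adj-sym {inj₁ _} {inj₂ _} ab = ab
  Adj-sym {inj₂ _} {inj₁ _} ab = ab
  Adj-sym {inj₂ _} {inj₂ _} ab = ab ∘ sym

  V-adjacent : ∀ {x y} → inj₂ {A = Fin n} x ≢ inj₂ y → Adj (inj₂ x) (inj₂ y)
  V-adjacent x≢y = x≢y ∘ cong inj₂

  SameEdge-refl : ∀ {p} → SameEdge p p
  SameEdge-refl = inj₁ (refl , refl)

  SameEdge-flip : ∀ {a b q} → SameEdge (a , b) q → SameEdge (b , a) q
  SameEdge-flip (inj₁ (a≡c , b≡d)) = inj₂ (b≡d , a≡c)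
  SameEdge-flip (inj₂ (a≡d , b≡c)) = inj₁ (b≡c , a≡d)

  SameEdge-trans : ∀ {p q r} → SameEdge p q → SameEdge q r → SameEdge p r
  SameEdge-trans {_ , _} {_ , _} {_ , _} (inj₁ (refl , refl)) q≈r = q≈r
  SameEdge-trans (inj₂ (refl , refl)) (inj₁ (refl , refl)) = inj₂ (refl , refl)
  SameEdge-trans (inj₂ (refl , refl)) (inj₂ (refl , refl)) = inj₁ (refl , refl)

  uv-injective : ∀ {x y x′ y′} → SameEdge (uv x y) (uv x′ y′) → x ≡ x′ × y ≡ y′
  uv-injective (inj₁ (refl , refl)) = refl , refl
  uv-injective (inj₂ (() , _))

  uv-conflict : ∀ {x y z w} → ¬ (x <P y) → ¬ (z <P w) → ¬ ¬ (x <P w) → ¬ ¬ (z <P y) →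
                Conflict (uv x y) (uv z w)
  uv-conflict x≮y z≮w x<w z<y = inj₁
    ( (λ ()) , (λ { refl → z<y x≮y }) , (λ ()) , (λ ()) , (λ { refl → x<w x≮y }) , (λ ())
    , x<w , z<y )

  record Crossing (x y : Fin n) (q : Pair) : Set where
    field
      z w      : Fin n
      is-uv    : SameEdge q (uv z w)
      adjacent : ¬ (z <P w)
      x<w      : ¬ ¬ (x <P w)
      z<y      : ¬ ¬ (z <P y)

  Crossing-flip : ∀ {x y c d} → Crossing x y (c , d) → Crossing x y (d , c)
  Crossing-flip cr = record
    { z = z ; w = w ; is-uv = SameEdge-flip is-uv ; adjacent = adjacent ; x<w = x<w ; z<y = z<y }
    where open Crossing cr

  crossing-uv : ∀ {x y c d} → Adj c d → ConflictOrd (inj₁ x) (inj₂ y) c d → Crossing x y (c , d)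
  crossing-uv {c = inj₁ z} {inj₂ w} adj (_ , _ , _ , _ , _ , _ , x<w , z<y) =
    record { z = z ; w = w ; is-uv = SameEdge-refl ; adjacent = adj ; x<w = x<w ; z<y = z<y }
  crossing-uv {c = inj₁ _} {inj₁ _} ()
  crossing-uv {c = inj₂ _} _ (_ , _ , _ , y≢c , _ , _ , _ , y≁c) = ⊥-elim (y≁c (V-adjacent y≢c))

  crossing-vu : ∀ {x y c d} → Adj c d → ConflictOrd (inj₂ y) (inj₁ x) c d → Crossing x y (c , d)
  crossing-vu {d = inj₂ _} _ (_ , _ , y≢d , _ , _ , _ , y≁d , _) = ⊥-elim (y≁d (V-adjacent y≢d))
  crossing-vu {c = inj₁ _} {inj₁ _} ()
  crossing-vu {c = inj₂ w} {inj₁ z} adj (_ , _ , _ , _ , _ , _ , z<y , x<w) =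
    record { z = z ; w = w ; is-uv = inj₂ (refl , refl) ; adjacent = adj ; x<w = x<w ; z<y = z<y }

  Conflict-flipˡ : ∀ {a b q} → Conflict (b , a) q → Conflict (a , b) q
  Conflict-flipˡ {q = _ , _} (inj₁ c)                = inj₂ (inj₁ c)
  Conflict-flipˡ {q = _ , _} (inj₂ (inj₁ c))         = inj₁ c
  Conflict-flipˡ {q = _ , _} (inj₂ (inj₂ (inj₁ c)))  = inj₂ (inj₂ (inj₂ c))
  Conflict-flipˡ {q = _ , _} (inj₂ (inj₂ (inj₂ c)))  = inj₂ (inj₂ (inj₁ c))

  crossing : ∀ {p q x y} → SameEdge p (uv x y) → IsEdge q → Conflict p q → Crossing x y q
  crossing {p = _ , _} {c , d} (inj₁ (refl , refl)) = from-uv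
    where
    from-uv : Adj c d → Conflict (uv _ _) (c , d) → Crossing _ _ (c , d)
    from-uv cd (inj₁ o)                = crossing-uv cd o
    from-uv cd (inj₂ (inj₁ o))         = crossing-vu cd o
    from-uv cd (inj₂ (inj₂ (inj₁ o)))  = Crossing-flip (crossing-uv (Adj-sym cd) o)
    from-uv cd (inj₂ (inj₂ (inj₂ o)))  = Crossing-flip (crossing-vu (Adj-sym cd) o)
  crossing {p = _ , _} {_ , _} (inj₂ (refl , refl)) cd cf =
    crossing SameEdge-refl cd (Conflict-flipˡ cf)

  -- The AC₆ u₀ v₀ u₁ v₁ u₂ v₂ with non-edges u_i v_i and edges u_{i+1} v_i (indices mod 3).
  record Crown : Set where
    field
      u v     : Fin 3 → Fin n
      paired  : ∀ i → ¬ ¬ (u i <P v i)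
      crossed : ∀ i → ¬ (u (next i) <P v i)
  open Crown public

  edge : Crown → Fin 3 → Pair
  edge K i = uv (u K (next i)) (v K i)

  antipodal : Crown → Fin 3 → Pair
  antipodal K i = uv (u K (prev i)) (v K i)

  mkCrown : ∀ {a b c d e f} → ¬ ¬ (a <P b) → ¬ ¬ (c <P d) → ¬ ¬ (e <P f) →
            ¬ (c <P b) → ¬ (e <P d) → ¬ (a <P f) → Crown
  mkCrown {a} {b} {c} {d} {e} {f} a<b c<d e<f c≮b e≮d a≮f = record
    { u       = a ∷ c ∷ e ∷ []
    ; v       = b ∷ d ∷ f ∷ []
    ; paired  = λ { 0F → a<b ; 1F → c<d ; 2F → e<f }
    ; crossed = λ { 0F → c≮b ; 1F → e≮d ; 2F → a≮f }
    }

  rotate : Crown → Crown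
  rotate K = record
    { u = u K ∘ next ; v = v K ∘ next ; paired = paired K ∘ next ; crossed = crossed K ∘ next }

  CrownEdges : (Fin 3 → Pair) → Set
  CrownEdges e = Σ Crown λ K → Σ (Fin 3 → Fin 3) λ ρ →
                 Injective _≡_ _≡_ ρ × (∀ j → SameEdge (e j) (edge K (ρ j)))

  -- Non-edges inside V and edges inside U are impossible, so an AC₆ alternates between U and V.
  alternating : ∀ {w₀ w₁ w₂ w₃ w₄ w₅} → w₀ ≢ w₁ → w₂ ≢ w₃ → w₄ ≢ w₅ →
    ¬ Adj w₀ w₁ → Adj w₁ w₂ → ¬ Adj w₂ w₃ → Adj w₃ w₄ → ¬ Adj w₄ w₅ → Adj w₅ w₀ →
    CrownEdges ((w₁ , w₂) ∷ (w₃ , w₄) ∷ (w₅ , w₀) ∷ [])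
  alternating {inj₁ _} {w₅ = inj₁ _} _ _ _ _ _ _ _ _ ()
  alternating {inj₁ _} {w₄ = inj₂ _} {inj₂ _} _ _ w₄≢w₅ _ _ _ _ n₄₅ _ = ⊥-elim (n₄₅ (V-adjacent w₄≢w₅))
  alternating {inj₁ _} {w₃ = inj₁ _} {inj₁ _} _ _ _ _ _ _ () _ _
  alternating {inj₁ _} {w₂ = inj₂ _} {inj₂ _} _ w₂≢w₃ _ _ _ n₂₃ _ _ _ = ⊥-elim (n₂₃ (V-adjacent w₂≢w₃))
  alternating {inj₁ _} {inj₁ _} {inj₁ _} _ _ _ _ () _ _ _ _
  alternating {inj₁ _} {inj₂ _} {inj₁ _} {inj₂ _} {inj₁ _} {inj₂ _} _ _ _ n₀₁ e₁₂ n₂₃ e₃₄ n₄₅ e₅₀ =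
    mkCrown n₀₁ n₂₃ n₄₅ e₁₂ e₃₄ e₅₀ , (λ j → j) , (λ eq → eq) ,
    λ { 0F → inj₂ (refl , refl) ; 1F → inj₂ (refl , refl) ; 2F → inj₂ (refl , refl) }
  alternating {inj₂ _} {inj₂ _} w₀≢w₁ _ _ n₀₁ _ _ _ _ _ = ⊥-elim (n₀₁ (V-adjacent w₀≢w₁))
  alternating {inj₂ _} {inj₁ _} {inj₁ _} _ _ _ _ () _ _ _ _
  alternating {inj₂ _} {inj₁ _} {inj₂ _} {inj₂ _} _ w₂≢w₃ _ _ _ n₂₃ _ _ _ = ⊥-elim (n₂₃ (V-adjacent w₂≢w₃))
  alternating {inj₂ _} {inj₁ _} {inj₂ _} {inj₁ _} {inj₁ _} _ _ _ _ _ _ () _ _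
  alternating {inj₂ _} {inj₁ _} {inj₂ _} {inj₁ _} {inj₂ _} {inj₂ _} _ _ w₄≢w₅ _ _ _ _ n₄₅ _ =
    ⊥-elim (n₄₅ (V-adjacent w₄≢w₅))
  alternating {inj₂ _} {inj₁ _} {inj₂ _} {inj₁ _} {inj₂ _} {inj₁ _} _ _ _ n₀₁ e₁₂ n₂₃ e₃₄ n₄₅ e₅₀ =
    mkCrown n₀₁ n₄₅ n₂₃ e₅₀ e₃₄ e₁₂ , opposite , opposite-injective ,
    λ { 0F → inj₁ (refl , refl) ; 1F → inj₁ (refl , refl) ; 2F → inj₁ (refl , refl) }

  AC6-crownEdges : ∀ {w} → AC6 w → CrownEdges (ac6Edge w)
  AC6-crownEdges {w} ac with alternating d12 d34 d56 n12 e23 n34 e45 n56 e61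
    where open AC6 ac
  ... | K , ρ , ρ-injective , same-edge =
    K , ρ , ρ-injective , λ { 0F → same-edge 0F ; 1F → same-edge 1F ; 2F → same-edge 2F }

module Colouring {n : ℕ} (_<P_ : Fin n → Fin n → Set) {k : ℕ}
  (comp : H.Pair _<P_ → Fin k) (χ₀ : H.Pair _<P_ → Bool)
  (components : ∀ a b c d → H.Adj _<P_ a b → H.Adj _<P_ c d →
     (comp (a , b) ≡ comp (c , d)) ⇔ H.Connected _<P_ (a , b) (c , d))
  (χ₀-symmetric : ∀ a b → H.Adj _<P_ a b → χ₀ (a , b) ≡ χ₀ (b , a))
  (χ₀-proper : ∀ a b c d → H.Adj _<P_ a b → H.Adj _<P_ c d →
     H.Conflict _<P_ (a , b) (c , d) → χ₀ (a , b) ≢ χ₀ (c , d)) where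

  open H _<P_
  open Crowns _<P_
  open Formula _<P_ comp χ₀

  connected : ∀ {p q} → IsEdge p → IsEdge q → comp p ≡ comp q → Connected p q
  connected {a , b} {c , d} ab cd = Equivalence.to (components a b c d ab cd)

  ℓ-flip : ∀ {a b} → Adj a b → ℓ (b , a) ≡ ℓ (a , b)
  ℓ-flip {a} {b} ab = cong₂ _,_
    (Equivalence.from (components b a a b ba ab) ((ba , ab , inj₂ (refl , refl)) ◅ ε))
    (sym (χ₀-symmetric a b ab))
    where
    ba : Adj b a
    ba = Adj-sym ab

  ℓ-cong : ∀ {p q} → SameEdge p q → IsEdge q → ℓ p ≡ ℓ q
  ℓ-cong {_ , _} {_ , _} (inj₁ (refl , refl)) _  = refl
  ℓ-cong {_ , _} {_ , _} (inj₂ (refl , refl)) ab = ℓ-flip ab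

  ℓ-conflict : ∀ {a b c d} → Adj a b → Adj c d → Conflict (a , b) (c , d) → ℓ (c , d) ≡ neg (ℓ (a , b))
  ℓ-conflict {a} {b} {c} {d} ab cd cf = cong₂ _,_
    (sym (Equivalence.from (components a b c d ab cd) ((ab , cd , inj₁ cf) ◅ ε)))
    (¬-not (χ₀-proper a b c d ab cd cf ∘ sym))

  ℓ-cross : ∀ {x y z w} → ¬ (x <P y) → ¬ (z <P w) → ¬ ¬ (x <P w) → ¬ ¬ (z <P y) →
            ℓ (uv z w) ≡ neg (ℓ (uv x y))
  ℓ-cross x≮y z≮w x<w z<y = ℓ-conflict x≮y z≮w (uv-conflict x≮y z≮w x<w z<y)

  lit : Crown → Fin 3 → Lit k
  lit K i = ℓ (edge K i)

  connected-edges : ∀ {K K′ i j} → proj₁ (lit K i) ≡ proj₁ (lit K′ j) → Connected (edge K i) (edge K′ j)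
  connected-edges {K} {K′} {i} {j} = connected (crossed K i) (crossed K′ j)

  record Consistent (K : Crown) : Set where
    constructor complement-free
    field
      no-complements : ∀ i j → lit K i ≢ neg (lit K j)
  open Consistent

  rotate-consistent : ∀ {K} → Consistent K → Consistent (rotate K)
  rotate-consistent cons = complement-free λ i j → no-complements cons (next i) (next j)

  -- Otherwise edge i and edge (i+1) would be in conflict.
  antipodal-adjacent : ∀ {K} → Consistent K → ∀ i → ¬ (u K (prev i) <P v K i)
  antipodal-adjacent {K} cons i u<v = no-complements cons (next i) i
    (ℓ-cross (crossed K i) (crossed K (next i)) (paired K (next i))
      (λ u≮v → u≮v (subst (λ j → u K j <P v K i) (sym (next∘next≡prev i)) u<v)))

  lit-antipodal : ∀ {K} → Consistent K → ∀ i → ℓ (antipodal K i) ≡ neg (lit K (prev i))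
  lit-antipodal {K} cons i =
    ℓ-cross (crossed K (prev i)) (antipodal-adjacent cons i)
      (subst (λ j → ¬ ¬ (u K j <P v K i)) (sym (next∘prev≡id i)) (paired K i)) (paired K (prev i))

  -- The crown u₁ w z v₀ u₂ v₂.
  exchange : (K : Crown) → Consistent K → ∀ {z w} →
             ¬ ¬ (u K 1F <P w) → ¬ ¬ (z <P v K 0F) → ¬ (z <P w) → Crown
  exchange K cons x<w z<y z≮w =
    mkCrown x<w z<y (paired K 2F) z≮w (antipodal-adjacent cons 0F) (antipodal-adjacent cons 2F)

  -- Up to polarity, both cases keep the clause of the crown.
  data Transported (K K′ : Crown) : Set where
    same    : (∀ i → lit K′ i ≡ lit K i) → Transported K K′
    swapped : (∀ i → lit K′ i ≡ neg (lit K (swap₁₂ i))) → Transported K K′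

  exchange-lit : ∀ {K} (cons : Consistent K) {z w}
    (x<w : ¬ ¬ (u K 1F <P w)) (z<y : ¬ ¬ (z <P v K 0F)) (z≮w : ¬ (z <P w)) →
    ∀ i → lit (exchange K cons x<w z<y z≮w) i ≡ neg (lit K (swap₁₂ i))
  exchange-lit {K} cons x<w z<y z≮w = λ
    { 0F → ℓ-cross (crossed K 0F) z≮w x<w z<y
    ; 1F → lit-antipodal cons 0F
    ; 2F → lit-antipodal cons 2F
    }

  Transported-trans : ∀ {K₁ K₂ K₃} → Transported K₁ K₂ → Transported K₂ K₃ → Transported K₁ K₃
  Transported-trans (same f)    (same g)    = same λ i → trans (g i) (f i)
  Transported-trans (same f)    (swapped g) = swapped λ i → trans (g i) (cong neg (f (swap₁₂ i)))
  Transported-trans (swapped f) (same g)    = swapped λ i → trans (g i) (f i)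
  Transported-trans {K₁} {K₂} {K₃} (swapped f) (swapped g) = same λ i → begin
    lit K₃ i                                  ≡⟨ g i ⟩
    neg (lit K₂ (swap₁₂ i))                   ≡⟨ cong neg (f (swap₁₂ i)) ⟩
    neg (neg (lit K₁ (swap₁₂ (swap₁₂ i))))    ≡⟨ neg-involutive _ ⟩
    lit K₁ (swap₁₂ (swap₁₂ i))                ≡⟨ cong (lit K₁) (swap₁₂-involutive i) ⟩
    lit K₁ i                                  ∎
    where open ≡-Reasoning

  Transported-consistent : ∀ {K K′} → Transported K K′ → Consistent K → Consistent K′
  Transported-consistent (same f) cons = complement-free λ i j eq →
    no-complements cons i j (trans (sym (f i)) (trans eq (cong neg (f j))))
  Transported-consistent (swapped f) cons = complement-free λ i j eq →
    no-complements cons (swap₁₂ i) (swap₁₂ j)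
      (neg-injective (trans (sym (f i)) (trans eq (cong neg (f j)))))

  record Transport (K : Crown) (q : Pair) : Set where
    constructor reached
    field
      target      : Crown
      reaches     : SameEdge q (edge target 0F)
      keeps-u₂    : u target 2F ≡ u K 2F
      keeps-v₂    : v target 2F ≡ v K 2F
      transported : Transported K target

  transport-step : ∀ {K p q} → Consistent K → SameEdge p (edge K 0F) → Step p q → Transport K q
  transport-step {K} {_ , _} {_ , _} _ p≈ (_ , _ , inj₂ (refl , refl)) =
    reached K (SameEdge-flip p≈) refl refl (same λ _ → refl)
  transport-step {K} {_ , _} {_ , _} cons p≈ (_ , q-edge , inj₁ cf) =
    reached (exchange K cons x<w z<y adjacent) is-uv refl refl
      (swapped (exchange-lit cons x<w z<y adjacent))
    where open Crossing (crossing p≈ q-edge cf)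

  transport : ∀ {K p q} → Consistent K → SameEdge p (edge K 0F) → Connected p q → Transport K q
  transport {K} _ p≈ ε = reached K p≈ refl refl (same λ _ → refl)
  transport cons p≈ (s ◅ path) with transport-step cons p≈ s
  ... | reached K₁ q≈ u₁ v₁ t₁ with transport (Transported-consistent t₁ cons) q≈ path
  ...   | reached K₂ r≈ u₂ v₂ t₂ = reached K₂ r≈ (trans u₂ u₁) (trans v₂ v₁) (Transported-trans t₁ t₂)

  -- Carrying rotate (rotate K′) onto edge 1 of K puts the non-edge u₁ v₁ of K in antipodal position.
  disconnected-across-u₁ : ∀ {K K′} → Consistent K′ → u K′ 1F ≡ u K 1F →
                           ¬ Connected (edge K′ 2F) (edge K 1F)
  disconnected-across-u₁ {K} {K′} cons′ u₁≡ path
    with transport (rotate-consistent (rotate-consistent cons′)) SameEdge-refl path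
  ... | reached K₃ reach u₂≡ _ t =
    paired K 1F (antipodal-adjacent cons₃ 0F ∘ subst₂ _<P_ (sym u-eq) v-eq)
    where
    cons₃ : Consistent K₃
    cons₃ = Transported-consistent t (rotate-consistent (rotate-consistent cons′))
    u-eq : u K₃ 2F ≡ u K 1F
    u-eq = trans u₂≡ u₁≡
    v-eq : v K 1F ≡ v K₃ 0F
    v-eq = proj₂ (uv-injective reach)

  -- Carry rotate K onto edge 1 of K′; a swapped arrival would negate the second literal.
  second-determines-third : ∀ {K K′} → Consistent K → Consistent K′ → v K′ 0F ≡ v K 0F →
                            lit K′ 1F ≡ lit K 1F → lit K′ 2F ≡ lit K 2F
  second-determines-third {K} {K′} cons cons′ v₀≡ lit₁≡
    with transport (rotate-consistent cons) SameEdge-refl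
           (connected-edges {rotate K} {K′} {0F} {1F} (cong proj₁ (sym lit₁≡)))
  ... | reached K₃ reach _ v₂≡ t = by-parity t
    where
    open ≡-Reasoning
    cons₃ : Consistent K₃
    cons₃ = Transported-consistent t (rotate-consistent cons)
    arrival : lit K₃ 0F ≡ lit K′ 1F
    arrival = sym (ℓ-cong reach (crossed K₃ 0F))
    by-parity : Transported (rotate K) K₃ → lit K′ 2F ≡ lit K 2F
    by-parity (same f) = begin
      lit K′ 2F                  ≡⟨ sym (neg-involutive _) ⟩
      neg (neg (lit K′ 2F))      ≡⟨ cong neg (sym (lit-antipodal cons′ 0F)) ⟩
      neg (ℓ (antipodal K′ 0F))  ≡⟨ cong (neg ∘ ℓ) (cong₂ uv (proj₁ (uv-injective reach)) (trans v₀≡ (sym v₂≡))) ⟩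
      neg (ℓ (antipodal K₃ 2F))  ≡⟨ cong neg (lit-antipodal cons₃ 2F) ⟩
      neg (neg (lit K₃ 1F))      ≡⟨ neg-involutive _ ⟩
      lit K₃ 1F                  ≡⟨ f 1F ⟩
      lit K 2F                   ∎
    by-parity (swapped f) = ⊥-elim (neg-≢ (lit K 1F) (trans (sym (trans arrival lit₁≡)) (f 0F)))

  record CrownClause (a b c : Lit k) : Set where
    field
      crown      : Crown
      consistent : Consistent crown
      polarity   : Bool
      at₀        : a ≡ pol polarity (lit crown 0F)
      at₁        : b ≡ pol polarity (lit crown 1F)
      at₂        : c ≡ pol polarity (lit crown 2F)

  CrownClause-cong : ∀ {a b c a′ b′ c′} → a ≡ a′ → b ≡ b′ → c ≡ c′ →
                     CrownClause a b c → CrownClause a′ b′ c′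
  CrownClause-cong refl refl refl r = r

  CrownClause-rotate : ∀ {a b c} → CrownClause a b c → CrownClause b c a
  CrownClause-rotate r = record
    { crown = rotate crown ; consistent = rotate-consistent consistent ; polarity = polarity
    ; at₀ = at₁ ; at₁ = at₂ ; at₂ = at₀ }
    where open CrownClause r

  -- Exchanging with the antipodal edge u₀ v₁ of edge 0.
  CrownClause-swap : ∀ {a b c} → CrownClause a b c → CrownClause a c b
  CrownClause-swap r = record
    { crown = K′ ; consistent = Transported-consistent (swapped lits) consistent
    ; polarity = not polarity ; at₀ = flipped 0F at₀ ; at₁ = flipped 1F at₂ ; at₂ = flipped 2F at₁ }
    where
    open CrownClause r
    x<w : ¬ ¬ (u crown 1F <P v crown 1F)
    x<w = paired crown 1F
    z<y : ¬ ¬ (u crown 0F <P v crown 0F)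
    z<y = paired crown 0F
    z≮w : ¬ (u crown 0F <P v crown 1F)
    z≮w = antipodal-adjacent consistent 1F
    K′ : Crown
    K′ = exchange crown consistent x<w z<y z≮w
    lits : ∀ i → lit K′ i ≡ neg (lit crown (swap₁₂ i))
    lits = exchange-lit consistent x<w z<y z≮w
    flipped : ∀ {x} i → x ≡ pol polarity (lit crown (swap₁₂ i)) → x ≡ pol (not polarity) (lit K′ i)
    flipped i eq = trans eq (sym (trans (cong (pol (not polarity)) (lits i)) (pol-not-neg polarity _)))

  CrownClause-arrange : (a : Fin 3 → Lit k) → ∀ x y z → x ≢ y → x ≢ z → y ≢ z →
                        CrownClause (a 0F) (a 1F) (a 2F) → CrownClause (a x) (a y) (a z)
  CrownClause-arrange _ 0F 1F 2F _ _ _ r = r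
  CrownClause-arrange _ 1F 2F 0F _ _ _ r = CrownClause-rotate r
  CrownClause-arrange _ 2F 0F 1F _ _ _ r = CrownClause-rotate (CrownClause-rotate r)
  CrownClause-arrange _ 0F 2F 1F _ _ _ r = CrownClause-swap r
  CrownClause-arrange _ 1F 0F 2F _ _ _ r = CrownClause-swap (CrownClause-rotate r)
  CrownClause-arrange _ 2F 1F 0F _ _ _ r = CrownClause-swap (CrownClause-rotate (CrownClause-rotate r))
  CrownClause-arrange _ 0F 0F _  x≢y _ _ _ = contradiction refl x≢y
  CrownClause-arrange _ 1F 1F _  x≢y _ _ _ = contradiction refl x≢y
  CrownClause-arrange _ 2F 2F _  x≢y _ _ _ = contradiction refl x≢y
  CrownClause-arrange _ 0F _  0F _ x≢z _ _ = contradiction refl x≢z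
  CrownClause-arrange _ 1F _  1F _ x≢z _ _ = contradiction refl x≢z
  CrownClause-arrange _ 2F _  2F _ x≢z _ _ = contradiction refl x≢z
  CrownClause-arrange _ _  0F 0F _ _ y≢z _ = contradiction refl y≢z
  CrownClause-arrange _ _  1F 1F _ _ y≢z _ = contradiction refl y≢z
  CrownClause-arrange _ _  2F 2F _ _ y≢z _ = contradiction refl y≢z

  -- Carry the second crown onto edge 0 of the first; the parity of the path decides between
  -- second-determines-third and disconnected-across-u₁.
  third-literal-unique : ∀ {a b c c′} → CrownClause a b c → CrownClause a b c′ → c ≡ c′
  third-literal-unique {c = c} {c′} r r′ =
    arrive (transport cons′ SameEdge-refl (connected-edges {K′} {K} {0F} {0F} (same-variable a≡′ a≡)))
    where
    open CrownClause r using ()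
      renaming (crown to K; consistent to cons; polarity to s; at₀ to a≡; at₁ to b≡; at₂ to c≡)
    open CrownClause r′ using ()
      renaming (crown to K′; consistent to cons′; polarity to s′; at₀ to a≡′; at₁ to b≡′; at₂ to c≡′)

    arrive : Transport K′ (edge K 0F) → c ≡ c′
    arrive (reached K″ reach _ _ (same f)) =
      trans c≡ (trans (cong (pol s) (sym third)) (trans (agrees 2F) (sym c≡′)))
      where
      s≡s′ : s ≡ s′
      s≡s′ = pol-injectiveˡ (lit K 0F)
        (trans (sym a≡) (trans a≡′ (cong (pol s′) (trans (sym (f 0F)) (sym (ℓ-cong reach (crossed K″ 0F)))))))
      agrees : ∀ i → pol s (lit K″ i) ≡ pol s′ (lit K′ i)
      agrees i = trans (cong (λ σ → pol σ (lit K″ i)) s≡s′) (cong (pol s′) (f i))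
      third : lit K″ 2F ≡ lit K 2F
      third = second-determines-third {K} {K″} cons (Transported-consistent (same f) cons′)
        (sym (proj₂ (uv-injective reach))) (pol-injectiveʳ s (trans (agrees 1F) (trans (sym b≡′) b≡)))
    arrive (reached K″ reach _ _ (swapped f)) =
      ⊥-elim (disconnected-across-u₁ {K} {K″} (Transported-consistent (swapped f) cons′)
        (sym (proj₁ (uv-injective reach)))
        (connected-edges {K″} {K} {2F} {1F} (trans (cong proj₁ (f 2F)) (same-variable b≡′ b≡))))

  CrownClause-of-φ₁ : ∀ {c} → Clauseφ₁ c → CrownClause (c 0F) (c 1F) (c 2F)
  CrownClause-of-φ₁ {c} (t , (w , ac , σ , σ-injective , t≈w) , no-complement , s , c≡)
    with AC6-crownEdges ac
  ... | K , ρ , ρ-injective , w≈K =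
    CrownClause-cong (c-at 0F) (c-at 1F) (c-at 2F)
      (CrownClause-arrange A (τ 0F) (τ 1F) (τ 2F) (distinct λ ()) (distinct λ ()) (distinct λ ()) base)
    where
    τ : Fin 3 → Fin 3
    τ = ρ ∘ σ
    τ-injective : Injective _≡_ _≡_ τ
    τ-injective = σ-injective ∘ ρ-injective
    distinct : ∀ {i j} → i ≢ j → τ i ≢ τ j
    distinct = contraInjective τ-injective
    lit-t : ∀ i → ℓ (t i) ≡ lit K (τ i)
    lit-t i = ℓ-cong (SameEdge-trans (t≈w i) (w≈K (σ i))) (crossed K (τ i))
    no-complements′ : ∀ p q → lit K p ≢ neg (lit K q)
    no-complements′ p q with injective⇒surjective τ-injective p | injective⇒surjective τ-injective q
    ... | i , refl | j , refl = λ eq →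
      no-complement i j (trans (lit-t i) (trans eq (cong neg (sym (lit-t j)))))
    A : Fin 3 → Lit k
    A j = pol s (lit K j)
    base : CrownClause (A 0F) (A 1F) (A 2F)
    base = record
      { crown = K ; consistent = complement-free no-complements′ ; polarity = s
      ; at₀ = refl ; at₁ = refl ; at₂ = refl }
    c-at : ∀ i → A (τ i) ≡ c i
    c-at i = sym (trans (c≡ i) (cong (pol s) (lit-t i)))

lemma16 : (n : ℕ) (_<P_ : Fin n → Fin n → Set) →
    IsStrictPartialOrder _≡_ _<P_ →
    (k : ℕ) (comp : H.Pair _<P_ → Fin k) (χ₀ : H.Pair _<P_ → Bool) →
    (∀ a b c d → H.Adj _<P_ a b → H.Adj _<P_ c d →
    (comp (a , b) ≡ comp (c , d)) ⇔ H.Connected _<P_ (a , b) (c , d)) →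
    (∀ a b → H.Adj _<P_ a b → χ₀ (a , b) ≡ χ₀ (b , a)) →
    (∀ a b c d → H.Adj _<P_ a b → H.Adj _<P_ c d →
    H.Conflict _<P_ (a , b) (c , d) → χ₀ (a , b) ≢ χ₀ (c , d)) →
    (c c′ : Fin 3 → Lit k) →
    Formula.Clauseφ₁ _<P_ comp χ₀ c →
    Formula.Clauseφ₁ _<P_ comp χ₀ c′ →
    c zero ≢ c (suc zero) →
    c zero ≡ c′ zero → c (suc zero) ≡ c′ (suc zero) →
    c (suc (suc zero)) ≡ c′ (suc (suc zero))
lemma16 _ _<P_ _ _ comp χ₀ components χ₀-symmetric χ₀-proper c c′ clause clause′ _ e₀ e₁ =
  third-literal-unique (CrownClause-cong e₀ e₁ refl (CrownClause-of-φ₁ clause)) (CrownClause-of-φ₁ clause′)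
  where open Colouring _<P_ comp χ₀ components χ₀-symmetric χ₀-proper
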